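{- Let $R$ be a commutative ring and let $G_1,G_2$ be edge labeled graphs over $R$ with $V(G_1)\cap V(G_2)=\{z\}$. Let $G=G_1\cup G_2$ be the graph obtained by pasting $G_1$ and $G_2$ at $z$, with edge labeling $\alpha$ restricting to the given labelings. Let $u\in V(G_1)$ and $w\in V(G_2)$. Then, with all paths taken in $G$, $$\Big(\bigcap_{P\in\mathcal{P}_{(u,z)}}\alpha(P)\Big)+\Big(\bigcap_{P\in\mathcal{P}_{(z,w)}}\alpha(P)\Big)\subseteq\bigcap_{P\in\mathcal{P}_{(u,w)}}\alpha(P).$$
   Context: Graphs are finite. An edge labeling of a graph $G=(V,E)$ over a commutative ring $R$ is a function $\alpha:E\to\mathcal{I}(R)$ assigning to each edge an ideal of $R$. For vertices $u,w$, $\mathcal{P}_{(u,w)}$ denotes the set of all paths from $u$ to $w$, and for a path $P$ with edges $e_1,\dots,e_k$, $\alpha(P)=\alpha(e_1)+\cdots+\alpha(e_k)$ (sum of ideals). -}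

module Defs where

open import Level using (Level; _⊔_; 0ℓ; Lift) renaming (suc to lsuc)
open import Algebra.Bundles using (CommutativeRing)
open import Data.Nat using (ℕ)
open import Data.Fin using (Fin)
open import Data.List using (List; []; _∷_)
open import Data.List.Relation.Unary.Unique.Propositional using (Unique)
open import Data.Product using (Σ; _×_; _,_)
open import Relation.Binary.PropositionalEquality using (_≡_)
open import Relation.Nullary using (¬_)

module IdealsOver {c ℓ : Level} (R : CommutativeRing c ℓ) where
  open CommutativeRing R

  SubsetR : Set (lsuc (c ⊔ ℓ))
  SubsetR = Carrier → Set (c ⊔ ℓ)

  _⊆R_ : SubsetR → SubsetR → Set (c ⊔ ℓ)
  A ⊆R B = ∀ x → A x → B x

  record Ideal : Set (lsuc (c ⊔ ℓ)) where
    field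
      mem      : SubsetR
      ∈-resp-≈ : ∀ {x y} → x ≈ y → mem x → mem y
      0#∈      : mem 0#
      +-closed : ∀ {x y} → mem x → mem y → mem (x + y)
      *-closed : ∀ r {x} → mem x → mem (r * x)
  open Ideal public

  zeroIdeal : SubsetR
  zeroIdeal x = Lift c (x ≈ 0#)

  _⊕_ : SubsetR → SubsetR → SubsetR
  (A ⊕ B) x = Σ Carrier λ a → Σ Carrier λ b → A a × B b × (x ≈ a + b)

  -- A finite (simple, undirected) graph on vertex set Fin n with an
  -- edge labeling α by ideals of R.  α u v is the label of the edge {u,v}
  -- (only meaningful when E u v holds); it is symmetric.
  record EdgeLabeledGraph (n : ℕ) : Set (lsuc (c ⊔ ℓ)) where
    field
      E       : Fin n → Fin n → Set
      E-sym   : ∀ {u v} → E u v → E v u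
      E-irr   : ∀ {u} → ¬ E u u
      α       : Fin n → Fin n → Ideal
      α-sym   : ∀ u v → mem (α u v) ⊆R mem (α v u)

  module _ {n : ℕ} (G : EdgeLabeledGraph n) where
    open EdgeLabeledGraph G

    data Walk : Fin n → Fin n → Set where
      []   : ∀ {v} → Walk v v
      step : ∀ u {v w} → E u v → Walk v w → Walk u w

    vertices : ∀ {u w} → Walk u w → List (Fin n)
    vertices ([] {v})    = v ∷ []
    vertices (step u _ p) = u ∷ vertices p

    αW : ∀ {u w} → Walk u w → SubsetR
    αW []                 = zeroIdeal
    αW (step u {v} _ p)   = mem (α u v) ⊕ αW p

    record Path (u w : Fin n) : Set where
      constructor path
      field
        walk     : Walk u w
        distinct : Unique (vertices walk)

    αP : ∀ {u w} → Path u w → SubsetR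
    αP P = αW (Path.walk P)

    ⋂paths : Fin n → Fin n → SubsetR
    ⋂paths u w x = ∀ (P : Path u w) → αP P x

-- A path from G₁ to G₂ must pass through the cut vertex z, since no edge
-- joins G₁ ∖ {z} to G₂ ∖ {z}.  Cutting it at its first visit to z gives a
-- path P₁ from u to z followed by a path P₂ from z to w, and
-- α(P₁) + α(P₂) ⊆ α(P); an element a + b with a in every α(P₁) and b in
-- every α(P₂) therefore lies in α(P).
module Submission where

open import Defs
open import Level using (Level; lift)
open import Algebra.Bundles using (CommutativeRing)
open import Data.Nat using (ℕ; zero; suc)
open import Data.Fin using (Fin; _≟_)
open import Data.List using (_∷_; take; drop)
open import Data.List.Relation.Unary.Unique.Propositional using (Unique)
open import Data.List.Relation.Unary.Unique.Propositional.Properties using (take⁺; drop⁺)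
open import Data.Product using (Σ-syntax; _×_; _,_)
open import Data.Sum using (_⊎_; inj₁; inj₂)
open import Data.Empty using (⊥-elim)
open import Relation.Binary.PropositionalEquality using (_≡_; refl; cong; subst)
open import Relation.Nullary using (yes; no)

module _ {c ℓ : Level} (R : CommutativeRing c ℓ) where
  open CommutativeRing R using (_≈_; _+_; +-cong; +-assoc; +-identityˡ)
    renaming (refl to ≈-refl; sym to ≈-sym; trans to ≈-trans)
  open IdealsOver R

  ⊕-mono : ∀ {A A′ B B′ : SubsetR} → A ⊆R A′ → B ⊆R B′ → (A ⊕ B) ⊆R (A′ ⊕ B′)
  ⊕-mono A⊆A′ B⊆B′ x (a , b , a∈A , b∈B , x≈a+b) =
    a , b , A⊆A′ a a∈A , B⊆B′ b b∈B , x≈a+b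

  ⊕-identityˡ : ∀ {A : SubsetR} → (∀ {x y} → x ≈ y → A x → A y) →
                (zeroIdeal ⊕ A) ⊆R A
  ⊕-identityˡ A-resp-≈ x (a , b , lift a≈0 , b∈A , x≈a+b) =
    A-resp-≈ (≈-sym (≈-trans x≈a+b (≈-trans (+-cong a≈0 ≈-refl) (+-identityˡ b)))) b∈A

  ⊕-assocʳ : ∀ {A B C : SubsetR} → ((A ⊕ B) ⊕ C) ⊆R (A ⊕ (B ⊕ C))
  ⊕-assocʳ x (s , d , (a , b , a∈A , b∈B , s≈a+b) , d∈C , x≈s+d) =
    a , b + d , a∈A , (b , d , b∈B , d∈C , ≈-refl) ,
    ≈-trans x≈s+d (≈-trans (+-cong s≈a+b ≈-refl) (+-assoc a b d))

  module _ {n : ℕ} (G : EdgeLabeledGraph n) where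
    open EdgeLabeledGraph G

    infixr 5 _++ᵂ_
    _++ᵂ_ : ∀ {u v w} → Walk G u v → Walk G v w → Walk G u w
    []         ++ᵂ q = q
    step u e p ++ᵂ q = step u e (p ++ᵂ q)

    length : ∀ {u w} → Walk G u w → ℕ
    length []           = zero
    length (step _ _ p) = suc (length p)

    take-vertices-++ᵂ : ∀ {u v w} (p : Walk G u v) (q : Walk G v w) →
                        take (suc (length p)) (vertices G (p ++ᵂ q)) ≡ vertices G p
    take-vertices-++ᵂ [] []           = refl
    take-vertices-++ᵂ [] (step _ _ _) = refl
    take-vertices-++ᵂ (step u _ p) q  = cong (u ∷_) (take-vertices-++ᵂ p q)

    drop-vertices-++ᵂ : ∀ {u v w} (p : Walk G u v) (q : Walk G v w) →
                        drop (length p) (vertices G (p ++ᵂ q)) ≡ vertices G q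
    drop-vertices-++ᵂ [] q           = refl
    drop-vertices-++ᵂ (step _ _ p) q = drop-vertices-++ᵂ p q

    Unique-++ᵂ⁻ˡ : ∀ {u v w} (p : Walk G u v) (q : Walk G v w) →
                   Unique (vertices G (p ++ᵂ q)) → Unique (vertices G p)
    Unique-++ᵂ⁻ˡ p q distinct =
      subst Unique (take-vertices-++ᵂ p q) (take⁺ (suc (length p)) distinct)

    Unique-++ᵂ⁻ʳ : ∀ {u v w} (p : Walk G u v) (q : Walk G v w) →
                   Unique (vertices G (p ++ᵂ q)) → Unique (vertices G q)
    Unique-++ᵂ⁻ʳ p q distinct =
      subst Unique (drop-vertices-++ᵂ p q) (drop⁺ (length p) distinct)

    αW-resp-≈ : ∀ {u w} (p : Walk G u w) {x y} → x ≈ y → αW G p x → αW G p y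
    αW-resp-≈ [] x≈y (lift x≈0) = lift (≈-trans (≈-sym x≈y) x≈0)
    αW-resp-≈ (step _ _ _) x≈y (a , b , a∈ , b∈ , x≈a+b) =
      a , b , a∈ , b∈ , ≈-trans (≈-sym x≈y) x≈a+b

    αW-++ᵂ : ∀ {u v w} (p : Walk G u v) (q : Walk G v w) →
             (αW G p ⊕ αW G q) ⊆R αW G (p ++ᵂ q)
    αW-++ᵂ [] q = ⊕-identityˡ (αW-resp-≈ q)
    αW-++ᵂ (step _ _ p) q x x∈ =
      ⊕-mono (λ _ a∈ → a∈) (αW-++ᵂ p q) x (⊕-assocʳ x x∈)

    module _ (V₁ V₂ : Fin n → Set) (z : Fin n)
             (V₁∩V₂⊆z : ∀ v → V₁ v → V₂ v → v ≡ z)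
             (edges-within : ∀ u v → E u v → (V₁ u × V₁ v) ⊎ (V₂ u × V₂ v)) where

      walk-through-cut : ∀ {u w} (p : Walk G u w) → V₁ u → V₂ w →
                         Σ[ p₁ ∈ Walk G u z ] Σ[ p₂ ∈ Walk G z w ] p ≡ p₁ ++ᵂ p₂
      walk-through-cut {u} p u∈V₁ w∈V₂ with u ≟ z
      ... | yes refl = [] , p , refl
      walk-through-cut [] u∈V₁ u∈V₂ | no u≢z = ⊥-elim (u≢z (V₁∩V₂⊆z _ u∈V₁ u∈V₂))
      walk-through-cut (step u {v} e q) u∈V₁ w∈V₂ | no u≢z with edges-within u v e
      ... | inj₂ (u∈V₂ , _) = ⊥-elim (u≢z (V₁∩V₂⊆z u u∈V₁ u∈V₂))
      ... | inj₁ (_ , v∈V₁) with walk-through-cut q v∈V₁ w∈V₂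
      ...   | q₁ , q₂ , q≡q₁++q₂ = step u e q₁ , q₂ , cong (step u e) q≡q₁++q₂

      path-through-cut : ∀ {u w} (P : Path G u w) → V₁ u → V₂ w →
                         Σ[ P₁ ∈ Path G u z ] Σ[ P₂ ∈ Path G z w ]
                           (αP G P₁ ⊕ αP G P₂) ⊆R αP G P
      path-through-cut (path p distinct) u∈V₁ w∈V₂
        with walk-through-cut p u∈V₁ w∈V₂
      ... | p₁ , p₂ , refl =
        path p₁ (Unique-++ᵂ⁻ˡ p₁ p₂ distinct) ,
        path p₂ (Unique-++ᵂ⁻ʳ p₁ p₂ distinct) ,
        αW-++ᵂ p₁ p₂

mainTheorem6 : ∀ {c ℓ : Level} (R : CommutativeRing c ℓ) {n : ℕ}
    (G : IdealsOver.EdgeLabeledGraph R n)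
    (V₁ V₂ : Fin n → Set) (z : Fin n)
    → V₁ z → V₂ z
    → (∀ v → V₁ v → V₂ v → v ≡ z)
    → (∀ v → V₁ v ⊎ V₂ v)
    → (∀ u v → IdealsOver.EdgeLabeledGraph.E G u v → (V₁ u × V₁ v) ⊎ (V₂ u × V₂ v))
    → (u w : Fin n) → V₁ u → V₂ w
    → IdealsOver._⊆R_ R
        (IdealsOver._⊕_ R (IdealsOver.⋂paths R G u z) (IdealsOver.⋂paths R G z w))
        (IdealsOver.⋂paths R G u w)
mainTheorem6 R G V₁ V₂ z _ _ V₁∩V₂⊆z _ edges-within u w u∈V₁ w∈V₂ x x∈ P
  with path-through-cut R G V₁ V₂ z V₁∩V₂⊆z edges-within P u∈V₁ w∈V₂
... | P₁ , P₂ , α[P₁]⊕α[P₂]⊆α[P] =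
  α[P₁]⊕α[P₂]⊆α[P] x (⊕-mono R (λ _ a∈⋂ → a∈⋂ P₁) (λ _ b∈⋂ → b∈⋂ P₂) x x∈)
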